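{- Let $(G,\omega)$ be a strictly weighted graph and $(G,\mathsf m_\omega)$ its marked version. Then the $W$-polynomial $W_{(G,\omega)}(\mathbf z,y)$ does not depend on $z_1$, and $$W_{(G,\omega)}(\mathbf z,y)=D_{(G,\mathsf m_\omega)}(z_{1,0}=0,\ z_{w,0}=z_w,\ y).$$
   Context: Graphs are finite and may have loops and multiple edges. A weighted graph is $(G,\omega)$ with $\omega:V(G)\to\{1,2,\dots\}$; it is strictly weighted if all weights exceed $1$; its marked version is $(G,\mathsf m_\omega)$ with $\mathsf m_\omega(v)=(\omega(v),0)$. Contracting a non-loop edge $e=uv$ deletes $e$ and merges $u,v$ into a new vertex inheriting all other incident edges, whose weight is $\omega(u)+\omega(v)$ (resp. whose mark is the dot-sum $(w,d)\dotplus(w',d')=(w+w',d+d'+1)$ of the two marks). The $W$-polynomial in commuting indeterminates $y,z_1,z_2,\dots$: a loop $e$ gives $W_{(G,\omega)}=y\,W_{(G\setminus e,\omega)}$; a non-loop $e$ gives $W_{(G,\omega)}=W_{(G\setminus e,\omega)}+W_{(G/e,\omega/e)}$; edgeless $G$ with weights $\omega_1,\dots,\omega_k$ gives $z_{\omega_1}\cdots z_{\omega_k}$. Marks are pairs $(w,d)$ of integers with $w\ge1,d\ge0,w\ge d+1$. The $M$-polynomial of a marked graph in indeterminates $y$, $z_{w,d}$: edgeless with marks $(w_i,d_i)$ gives $\prod z_{w_i,d_i}$; a loop gives the factor $y$ times $M$ of the graph with the loop deleted; a non-loop edge $e$ gives $M_{(G,\mathsf m)}=M_{(G\setminus e,\mathsf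 m)}+M_{(G/e,\mathsf m/e)}$. With $D_{\bullet_{w,d}}=\sum_{i=0}^d(-1)^i\binom di z_{w-i,0}z_{1,0}^i$, the $D$-polynomial is $M$ with every $z_{w,d}$ replaced by $D_{\bullet_{w,d}}$. -}

module Defs where

open import Data.Nat as ℕ using (ℕ; zero; suc; _∸_)
open import Data.Nat.Combinatorics using (_C_)
open import Data.Integer as ℤ using (ℤ; +_; -_)
open import Data.Fin using (Fin; punchIn; punchOut)
open import Data.Fin.Properties using (_≟_)
open import Data.Product using (_×_; _,_; proj₁; proj₂)
open import Data.List using (List; length)
open import Data.Vec using (Vec; []; _∷_; fromList; map)
open import Relation.Nullary using (yes; no)
open import Relation.Binary.PropositionalEquality using (_≡_; _≢_; sym)

record Graph (L : Set) : Set where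
  field
    n      : ℕ
    label  : Fin n → L
    edges  : List (Fin n × Fin n)
open Graph public

-- Contraction of a non-loop edge u v (u ≢ v) in a graph on Fin (suc m):
-- v is removed, u absorbs it; the merged label is  label u ⊕ label v.
module _ {L : Set} (_⊕_ : L → L → L) where

  contractVertex : ∀ {m} {u v : Fin (suc m)} → v ≢ u → Fin (suc m) → Fin m
  contractVertex {v = v} v≢u x with v ≟ x
  ... | yes _  = punchOut v≢u
  ... | no v≢x = punchOut v≢x

  contractLabel : ∀ {m} (u v : Fin (suc m)) → (Fin (suc m) → L) → Fin m → L
  contractLabel u v ℓ j with punchIn v j ≟ u
  ... | yes _ = ℓ u ⊕ ℓ v
  ... | no _  = ℓ (punchIn v j)

  -- Evaluation of the deletion–contraction polynomial at  y  and vertex values  z,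
  -- processing the edges in the given order (k = number of remaining edges):
  --   loop e      :  y · P(G ∖ e)
  --   non-loop e  :  P(G ∖ e) + P(G / e)
  --   edgeless    :  ∏ z(label v)
  prodVertices : ∀ n → (Fin n → L) → (L → ℤ) → ℤ
  prodVertices zero    ℓ z = + 1
  prodVertices (suc n) ℓ z = z (ℓ Fin.zero) ℤ.* prodVertices n (λ i → ℓ (Fin.suc i)) z

  dcEval : (y : ℤ) (z : L → ℤ) (k n : ℕ) → (Fin n → L) → Vec (Fin n × Fin n) k → ℤ
  dcEval y z zero    n       ℓ []              = prodVertices n ℓ z
  dcEval y z (suc k) zero    ℓ ((() , _) ∷ es)
  dcEval y z (suc k) (suc m) ℓ ((u , v) ∷ es) with u ≟ v
  ... | yes _  = y ℤ.* dcEval y z k (suc m) ℓ es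
  ... | no u≢v =
        dcEval y z k (suc m) ℓ es
        ℤ.+ dcEval y z k m (contractLabel u v ℓ)
                (map (λ e → contractVertex v≢u (proj₁ e) , contractVertex v≢u (proj₂ e)) es)
    where
    v≢u : v ≢ u
    v≢u p = u≢v (sym p)

  dcPoly : Graph L → (y : ℤ) → (L → ℤ) → ℤ
  dcPoly G y z = dcEval y z (length (edges G)) (n G) (label G) (fromList (edges G))

WGraph : Set
WGraph = Graph ℕ

Positive : WGraph → Set
Positive G = ∀ i → 1 ℕ.≤ label G i

StrictlyWeighted : WGraph → Set
StrictlyWeighted G = ∀ i → 2 ℕ.≤ label G i

W : WGraph → (y : ℤ) → (ℕ → ℤ) → ℤ
W = dcPoly ℕ._+_

Mark : Set
Mark = ℕ × ℕ

_∔_ : Mark → Mark → Mark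
(w , d) ∔ (w′ , d′) = (w ℕ.+ w′ , suc (d ℕ.+ d′))

markedVersion : WGraph → Graph Mark
markedVersion G = record { n = n G ; label = λ i → (label G i , 0) ; edges = edges G }

M : Graph Mark → (y : ℤ) → (ℕ → ℕ → ℤ) → ℤ
M G y z = dcPoly _∔_ G y (λ p → z (proj₁ p) (proj₂ p))

sumTo : ℕ → (ℕ → ℤ) → ℤ
sumTo zero    f = f 0
sumTo (suc d) f = sumTo d f ℤ.+ f (suc d)

Dbullet : (ℕ → ℤ) → ℕ → ℕ → ℤ
Dbullet z0 w d =
  sumTo d (λ i → (- + 1) ℤ.^ i ℤ.* + (d C i) ℤ.* z0 (w ∸ i) ℤ.* z0 1 ℤ.^ i)

D : Graph Mark → (y : ℤ) → (ℕ → ℤ) → ℤ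
D G y z0 = M G y (Dbullet z0)

subst1 : (ℕ → ℤ) → ℕ → ℤ
subst1 z 1 = + 0
subst1 z w = z w

{-# OPTIONS --safe #-}
module Submission where

open import Defs
open import Data.Nat using (ℕ; zero; suc; _+_; _∸_; _≤_)
open import Data.Nat.Combinatorics using (_C_)
open import Data.Nat.Properties using (>⇒≢; ≤-trans; m≤m+n)
open import Data.Integer as ℤ using (ℤ; 0ℤ; 1ℤ)
open import Data.Integer.Properties using (+-identityʳ; *-zeroʳ; *-identityˡ; *-identityʳ)
open import Data.Fin using (Fin; punchIn)
open import Data.Fin.Properties using (_≟_; punchOut-cong)
open import Data.Empty using (⊥-elim)
open import Data.Product using (_×_; _,_; proj₁; proj₂)
open import Data.List using (length)
open import Data.Vec using (Vec; []; _∷_; fromList)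
open import Data.Vec.Properties using (map-cong)
open import Relation.Nullary using (yes; no)
open import Relation.Binary.PropositionalEquality
  using (_≡_; _≢_; refl; cong; cong₂; trans; sym)

-- Every vertex weight arising in the deletion–contraction recursion of a
-- strictly weighted graph is a sum of weights ≥ 2, so z₁ is never evaluated.
-- Running the M-recursion of the marked version in lockstep, a vertex of
-- weight w carries a mark (w , d); at z₁,₀ = 0 every summand of D•(w,d) with
-- i ≥ 1 vanishes, leaving z_{w,0} = z_w.

-- contractVertex ignores both ⊕ and the proof of v ≢ u, but only
-- propositionally: it is stuck on v ≟ x for a variable x.
contractVertex-irrelevant :
  ∀ {L L′ : Set} {_⊕_ : L → L → L} {_⊕′_ : L′ → L′ → L′}
    {m} {u v : Fin (suc m)} (p q : v ≢ u) x →
  contractVertex _⊕_ p x ≡ contractVertex _⊕′_ q x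
contractVertex-irrelevant {v = v} p q x with v ≟ x
... | yes _ = punchOut-cong v refl
... | no  _ = refl

relabel : ∀ {L L′ : Set} (G : Graph L) → (Fin (n G) → L′) → Graph L′
relabel G ℓ′ = record { n = n G ; label = ℓ′ ; edges = edges G }

module Simulation
  {L L′ : Set} (_⊕_ : L → L → L) (_⊕′_ : L′ → L′ → L′) (_∼_ : L → L′ → Set)
  (∼-⊕ : ∀ {a b a′ b′} → a ∼ a′ → b ∼ b′ → (a ⊕ b) ∼ (a′ ⊕′ b′))
  (z : L → ℤ) (z′ : L′ → ℤ) (∼-z : ∀ {a a′} → a ∼ a′ → z a ≡ z′ a′)
  where

  Related : ∀ {n} → (Fin n → L) → (Fin n → L′) → Set
  Related ℓ ℓ′ = ∀ i → ℓ i ∼ ℓ′ i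

  prodVertices-sim : ∀ n {ℓ ℓ′} → Related ℓ ℓ′ →
    prodVertices _⊕_ n ℓ z ≡ prodVertices _⊕′_ n ℓ′ z′
  prodVertices-sim zero    ℓ∼ℓ′ = refl
  prodVertices-sim (suc n) ℓ∼ℓ′ =
    cong₂ ℤ._*_ (∼-z (ℓ∼ℓ′ Fin.zero)) (prodVertices-sim n (λ i → ℓ∼ℓ′ (Fin.suc i)))

  contractLabel-sim : ∀ {m} (u v : Fin (suc m)) {ℓ ℓ′} → Related ℓ ℓ′ →
    Related (contractLabel _⊕_ u v ℓ) (contractLabel _⊕′_ u v ℓ′)
  contractLabel-sim u v ℓ∼ℓ′ j with punchIn v j ≟ u
  ... | yes _ = ∼-⊕ (ℓ∼ℓ′ u) (ℓ∼ℓ′ v)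
  ... | no  _ = ℓ∼ℓ′ (punchIn v j)

  dcEval-sim : ∀ y k n {ℓ ℓ′} (es : Vec (Fin n × Fin n) k) → Related ℓ ℓ′ →
    dcEval _⊕_ y z k n ℓ es ≡ dcEval _⊕′_ y z′ k n ℓ′ es
  dcEval-sim y zero    n       []             ℓ∼ℓ′ = prodVertices-sim n ℓ∼ℓ′
  dcEval-sim y (suc k) zero    ((() , _) ∷ es)
  dcEval-sim y (suc k) (suc m) {ℓ′ = ℓ′} ((u , v) ∷ es) ℓ∼ℓ′ with u ≟ v
  ... | yes _   = cong (y ℤ.*_) (dcEval-sim y k (suc m) es ℓ∼ℓ′)
  ... | no  u≢v = cong₂ ℤ._+_ (dcEval-sim y k (suc m) es ℓ∼ℓ′)
      (trans (dcEval-sim y k m _ (contractLabel-sim u v ℓ∼ℓ′))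
             (cong (dcEval _⊕′_ y z′ k m (contractLabel _⊕′_ u v ℓ′))
                   (map-cong contract-irrelevant es)))
    where
    v≢u : v ≢ u
    v≢u v≡u = u≢v (sym v≡u)

    contract-irrelevant : ∀ (e : Fin (suc m) × Fin (suc m)) →
      (contractVertex _⊕_ v≢u (proj₁ e) , contractVertex _⊕_ v≢u (proj₂ e))
        ≡ (contractVertex _⊕′_ v≢u (proj₁ e) , contractVertex _⊕′_ v≢u (proj₂ e))
    contract-irrelevant (a , b) =
      cong₂ _,_ (contractVertex-irrelevant {_⊕_ = _⊕_} {_⊕′_} {u = u} {v} _ _ a)
                (contractVertex-irrelevant {_⊕_ = _⊕_} {_⊕′_} {u = u} {v} _ _ b)

  dcPoly-sim : ∀ (G : Graph L) {ℓ′} → Related (label G) ℓ′ → ∀ y →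
    dcPoly _⊕_ G y z ≡ dcPoly _⊕′_ (relabel G ℓ′) y z′
  dcPoly-sim G ℓ∼ℓ′ y =
    dcEval-sim y (length (edges G)) (n G) (fromList (edges G)) ℓ∼ℓ′

sumTo-*-^-zero : ∀ d (g : ℕ → ℤ) {x} → x ≡ 0ℤ →
  sumTo d (λ i → g i ℤ.* x ℤ.^ i) ≡ g 0 ℤ.* 1ℤ
sumTo-*-^-zero zero    g refl = refl
sumTo-*-^-zero (suc d) g refl
  rewrite sumTo-*-^-zero d g refl | *-zeroʳ (g (suc d)) = +-identityʳ (g 0 ℤ.* 1ℤ)

Dbullet-z₁≡0 : ∀ (z0 : ℕ → ℤ) → z0 1 ≡ 0ℤ → ∀ w d → Dbullet z0 w d ≡ z0 w
Dbullet-z₁≡0 z0 z₁≡0 w d =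
  trans (sumTo-*-^-zero d coefficient z₁≡0) (trans (*-identityʳ _) (*-identityˡ (z0 w)))
  where
  coefficient : ℕ → ℤ
  coefficient i = (ℤ.- ℤ.+ 1) ℤ.^ i ℤ.* ℤ.+ (d C i) ℤ.* z0 (w ∸ i)

subst1-≢1 : ∀ (z : ℕ → ℤ) {w} → w ≢ 1 → subst1 z w ≡ z w
subst1-≢1 z {zero}        w≢1 = refl
subst1-≢1 z {suc zero}    w≢1 = ⊥-elim (w≢1 refl)
subst1-≢1 z {suc (suc w)} w≢1 = refl

HeavyEqual : ℕ → ℕ → Set
HeavyEqual w w′ = 2 ≤ w × w ≡ w′

HeavyEqual-+ : ∀ {a b a′ b′} → HeavyEqual a a′ → HeavyEqual b b′ →
  HeavyEqual (a + b) (a′ + b′)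
HeavyEqual-+ {a} {b} (2≤a , refl) (_ , refl) = ≤-trans 2≤a (m≤m+n a b) , refl

corollary5p13 : (G : WGraph) → StrictlyWeighted G →
    ((y : ℤ) (z z′ : ℕ → ℤ) → (∀ w → w ≢ 1 → z w ≡ z′ w) → W G y z ≡ W G y z′)
    × ((y : ℤ) (z : ℕ → ℤ) → W G y z ≡ D (markedVersion G) y (subst1 z))
corollary5p13 G strict = independent-of-z₁ , W≡D
  where
  heavy : ∀ i → HeavyEqual (label G i) (label G i)
  heavy i = strict i , refl

  independent-of-z₁ : (y : ℤ) (z z′ : ℕ → ℤ) → (∀ w → w ≢ 1 → z w ≡ z′ w) →
    W G y z ≡ W G y z′
  independent-of-z₁ y z z′ agree =
    Simulation.dcPoly-sim _+_ _+_ HeavyEqual HeavyEqual-+ z z′ evaluation G heavy y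
    where
    evaluation : ∀ {w w′} → HeavyEqual w w′ → z w ≡ z′ w′
    evaluation (2≤w , refl) = agree _ (>⇒≢ 2≤w)

  W≡D : (y : ℤ) (z : ℕ → ℤ) → W G y z ≡ D (markedVersion G) y (subst1 z)
  W≡D y z =
    Simulation.dcPoly-sim _+_ _∔_ (λ w m → HeavyEqual w (proj₁ m)) HeavyEqual-+
      z (λ m → Dbullet (subst1 z) (proj₁ m) (proj₂ m))
      (λ {w} {m} → evaluation {w} {m}) G heavy y
    where
    evaluation : ∀ {w} {m : Mark} → HeavyEqual w (proj₁ m) →
      z w ≡ Dbullet (subst1 z) (proj₁ m) (proj₂ m)
    evaluation {m = w , d} (2≤w , refl) =
      sym (trans (Dbullet-z₁≡0 (subst1 z) refl w d) (subst1-≢1 z (>⇒≢ 2≤w)))
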